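{- Fix positive integers $r,s$ and let $f=f_{r,s}:\Sigma\to\Sigma$ be the one-dimensional generalized rotor-router map described in the context. For every integers $x\le 0\le y$ and every state $\sigma\in\Sigma(x,y)$ there exists $N\in\mathbb{N}$ such that $f^N(\sigma)\in\Sigma(x',y')$ for some integers $x'<x$ and $y'>y$.
   Context: For integers $a\le b$, $[a,b]=\{k\in\mathbb{Z}: a\le k\le b\}$ (empty if $a>b$). Fix positive integers $r,s$. A state consists of integers $x\le 0\le y$ (the occupied interval $[x,y]$) together with a labeling $\sigma:[x,y]\to\{L,R\}$; $\Sigma(x,y)$ is the set of states with occupied interval $[x,y]$, and $\Sigma=\bigcup_{x\le 0\le y}\Sigma(x,y)$. The map $f=f_{r,s}$ ("add one particle and let it equilibrate") is defined as follows: a particle starts at site $0$; whenever it is at an occupied site $k$, it moves to $k-1$ if the label at $k$ is $L$ and to $k+1$ if the label is $R$, and the label at $k$ is then switched ($L\leftrightarrow R$). When the particle first reaches an unoccupied site: if this site is $x-1$, the $r$ sites $[x-r,x-1]$ become occupied, all labeled $R$; if it is $y+1$, the $s$ sites $[y+1,y+s]$ become occupied, all labeled $R$. The resulting state is $f(\sigma)$. -}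

module Defs where

open import Data.Nat using (ℕ; zero; suc)
open import Data.Integer using (ℤ; +_; _+_; _-_; _≤_; _≤?_; _≟_; 0ℤ; 1ℤ)
open import Data.Bool using (if_then_else_; _∧_)
open import Relation.Nullary.Decidable using (⌊_⌋)
open import Relation.Binary.PropositionalEquality using (_≡_)
open import Data.Product using (_×_)

data Label : Set where
  L R : Label

-- The labeling is a total function ℤ → Label; only its values on [x , y]
-- are meaningful (values outside the interval are never read before
-- being overwritten).  The condition x ≤ 0 ≤ y is imposed in the theorem
-- (and is preserved by f).
record State : Set where
  constructor mkState
  field
    lo  : ℤ
    hi  : ℤ
    lab : ℤ → Label
open State public

InΣ : ℤ → ℤ → State → Set
InΣ x y σ = (lo σ ≡ x) × (hi σ ≡ y)

update : (ℤ → Label) → ℤ → Label → (ℤ → Label)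
update lab p v k = if ⌊ k ≟ p ⌋ then v else lab k

setR : (ℤ → Label) → ℤ → ℤ → (ℤ → Label)
setR lab a b k = if ⌊ a ≤? k ⌋ ∧ ⌊ k ≤? b ⌋ then R else lab k

-- Walk r s x y lab p τ : the particle currently at site p, in the
-- configuration with occupied interval [x , y] and labeling lab,
-- eventually equilibrates yielding the state τ.
data Walk (r s : ℕ) (x y : ℤ) : (ℤ → Label) → ℤ → State → Set where
  stepL : ∀ {lab p τ} → x ≤ p → p ≤ y → lab p ≡ L →
          Walk r s x y (update lab p R) (p - 1ℤ) τ → Walk r s x y lab p τ
  stepR : ∀ {lab p τ} → x ≤ p → p ≤ y → lab p ≡ R →
          Walk r s x y (update lab p L) (p + 1ℤ) τ → Walk r s x y lab p τ
  exitL : ∀ {lab p} → p ≡ x - 1ℤ →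
          Walk r s x y lab p (mkState (x - + r) y (setR lab (x - + r) (x - 1ℤ)))
  exitR : ∀ {lab p} → p ≡ y + 1ℤ →
          Walk r s x y lab p (mkState x (y + + s) (setR lab (y + 1ℤ) (y + + s)))

-- F r s σ τ  means  f_{r,s}(σ) = τ  (graph of f; the walk is deterministic)
F : ℕ → ℕ → State → State → Set
F r s σ τ = Walk r s (lo σ) (hi σ) (lab σ) 0ℤ τ

data Iter (r s : ℕ) : ℕ → State → State → Set where
  done : ∀ {σ} → Iter r s zero σ σ
  next : ∀ {N σ τ ρ} → F r s σ τ → Iter r s N τ ρ → Iter r s (suc N) σ ρ

-- Fix a cut between sites c and c + 1 of the occupied interval [x, y], and
-- measure a labeling by the number of R's on [x, c] plus the number of L's
-- on [c + 1, y].  A particle standing at c makes an excursion into [x, c]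
-- which either leaves the interval on the left or comes back to c + 1 with
-- strictly fewer R's on [x, c] (induction on the length of [x, c]);
-- symmetrically from c + 1.  The alternating excursions decrease the
-- measure, so every walk ends, and one that starts at c and leaves on the
-- right has lowered the number of R's on [x, c].  With c = 0 that number is
-- a variant for the iterates of f until the left end grows; with c = -1 the
-- number of L's on [0, y] is a variant until the right end grows.

module Submission where

open import Defs
open import Data.Nat using (ℕ)
open import Data.Integer using (ℤ; _≤_; _<_; 0ℤ)
open import Data.Product using (Σ; ∃; _×_)

open import Data.Bool using (true; false; if_then_else_; _∧_)
open import Data.Bool.Properties using (∧-zeroʳ)
open import Data.Nat as ℕ using (zero; suc)
import Data.Nat.Properties as ℕ
open import Data.Nat.Induction using (<-wellFounded)
open import Data.Integer using (+_; _+_; _-_; 1ℤ; -1ℤ; _≟_; _≤?_; ∣_∣; +≤+)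
import Data.Integer.Properties as ℤ
open import Data.Integer.Tactic.RingSolver using (solve-∀)
open import Data.Product using (_,_; proj₂)
open import Data.Sum using (_⊎_; inj₁; inj₂)
open import Induction.WellFounded using (Acc; acc)
open import Relation.Binary.Construct.Closure.ReflexiveTransitive
  using (Star; ε; _◅_; _◅◅_)
open import Relation.Nullary using (Dec; ¬_)
open import Relation.Nullary.Decidable using (⌊_⌋; isYes≗does; dec-true; dec-false)
open import Relation.Binary.PropositionalEquality
  using (_≡_; _≢_; refl; sym; trans; cong; cong₂; subst; module ≡-Reasoning)

p-1<p : ∀ p → p - 1ℤ < p
p-1<p p = ℤ.i≤pred[j]⇒i<j (ℤ.≤-reflexive (ℤ.+-comm p -1ℤ))

p<p+1 : ∀ p → p < p + 1ℤ
p<p+1 p = ℤ.suc[i]≤j⇒i<j (ℤ.≤-reflexive (ℤ.+-comm 1ℤ p))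

p-1+1≡p : ∀ p → p - 1ℤ + 1ℤ ≡ p
p-1+1≡p = solve-∀

p+1-1≡p : ∀ p → p + 1ℤ - 1ℤ ≡ p
p+1-1≡p = solve-∀

+suc-cancel : ∀ a n {b} → a + + suc n ≡ b + 1ℤ → a + + n ≡ b
+suc-cancel a n {b} eq = begin
  a + + n           ≡⟨ shift a (+ n) ⟩
  a + + suc n - 1ℤ  ≡⟨ cong (_- 1ℤ) eq ⟩
  b + 1ℤ - 1ℤ       ≡⟨ p+1-1≡p b ⟩
  b                 ∎
  where
  open ≡-Reasoning
  shift : ∀ a i → a + i ≡ a + (1ℤ + i) - 1ℤ
  shift = solve-∀

offset⇒≤ : ∀ {a b} n → a + + n ≡ b → a ≤ b
offset⇒≤ {a} n eq = subst (λ b → a ≤ b) eq (ℤ.i≤i+j a (+ n))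

≤⇒offset : ∀ {a b} → a ≤ b → Σ ℕ λ n → a + + n ≡ b
≤⇒offset {a} {b} a≤b = ∣ b - a ∣ , (begin
  a + + ∣ b - a ∣  ≡⟨ cong (λ i → a + i) (ℤ.0≤i⇒+∣i∣≡i (ℤ.i≤j⇒0≤j-i a≤b)) ⟩
  a + (b - a)      ≡⟨ cancel a b ⟩
  b                ∎)
  where
  open ≡-Reasoning
  cancel : ∀ a b → a + (b - a) ≡ b
  cancel = solve-∀

⌊⌋-true : ∀ {A : Set} (a? : Dec A) → A → ⌊ a? ⌋ ≡ true
⌊⌋-true a? a = trans (isYes≗does a?) (dec-true a? a)

⌊⌋-false : ∀ {A : Set} (a? : Dec A) → ¬ A → ⌊ a? ⌋ ≡ false
⌊⌋-false a? ¬a = trans (isYes≗does a?) (dec-false a? ¬a)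

update-same : ∀ l p v → update l p v p ≡ v
update-same l p v = cong (λ t → if t then v else l p) (⌊⌋-true (p ≟ p) refl)

update-other : ∀ l p v {k} → k ≢ p → update l p v k ≡ l k
update-other l p v {k} k≢p = cong (λ t → if t then v else l k) (⌊⌋-false (k ≟ p) k≢p)

setR-below : ∀ l a b {k} → k < a → setR l a b k ≡ l k
setR-below l a b {k} k<a =
  cong (λ t → if t ∧ ⌊ k ≤? b ⌋ then R else l k) (⌊⌋-false (a ≤? k) (ℤ.<⇒≱ k<a))

setR-above : ∀ l a b {k} → b < k → setR l a b k ≡ l k
setR-above l a b {k} b<k = cong (λ t → if t then R else l k)
  (trans (cong (⌊ a ≤? k ⌋ ∧_) (⌊⌋-false (k ≤? b) (ℤ.<⇒≱ b<k))) (∧-zeroʳ _))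

AgreeAbove AgreeBelow : ℤ → (ℤ → Label) → (ℤ → Label) → Set
AgreeAbove p l₁ l₂ = ∀ {k} → p < k → l₁ k ≡ l₂ k
AgreeBelow p l₁ l₂ = ∀ {k} → k < p → l₁ k ≡ l₂ k

update-agreeAbove : ∀ l p v → AgreeAbove p (update l p v) l
update-agreeAbove l p v p<k = update-other l p v (λ k≡p → ℤ.<⇒≢ p<k (sym k≡p))

update-agreeBelow : ∀ l p v → AgreeBelow p (update l p v) l
update-agreeBelow l p v k<p = update-other l p v (ℤ.<⇒≢ k<p)

agreeAbove-pred : ∀ {p l l′ v} → AgreeAbove (p - 1ℤ) l′ (update l p v) → AgreeAbove p l′ l
agreeAbove-pred {p} {l} {v = v} agree p<k =
  trans (agree (ℤ.<-trans (p-1<p p) p<k)) (update-agreeAbove l p v p<k)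

agreeBelow-suc : ∀ {p l l′ v} → AgreeBelow (p + 1ℤ) l′ (update l p v) → AgreeBelow p l′ l
agreeBelow-suc {p} {l} {v = v} agree k<p =
  trans (agree (ℤ.<-trans k<p (p<p+1 p))) (update-agreeBelow l p v k<p)

indR indL : Label → ℕ
indR L = 0
indR R = 1
indL L = 1
indL R = 0

#R↓ : (ℤ → Label) → ℤ → ℕ → ℕ
#R↓ l p zero    = 0
#R↓ l p (suc n) = indR (l p) ℕ.+ #R↓ l (p - 1ℤ) n

#L↑ : (ℤ → Label) → ℤ → ℕ → ℕ
#L↑ l p zero    = 0
#L↑ l p (suc n) = indL (l p) ℕ.+ #L↑ l (p + 1ℤ) n

#R↓-cong : ∀ n {p l₁ l₂} → (∀ {k} → k ≤ p → l₁ k ≡ l₂ k) → #R↓ l₁ p n ≡ #R↓ l₂ p n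
#R↓-cong zero    eq = refl
#R↓-cong (suc n) {p} eq = cong₂ ℕ._+_ (cong indR (eq ℤ.≤-refl))
  (#R↓-cong n (λ k≤p-1 → eq (ℤ.≤-trans k≤p-1 (ℤ.<⇒≤ (p-1<p p)))))

#L↑-cong : ∀ n {p l₁ l₂} → (∀ {k} → p ≤ k → l₁ k ≡ l₂ k) → #L↑ l₁ p n ≡ #L↑ l₂ p n
#L↑-cong zero    eq = refl
#L↑-cong (suc n) {p} eq = cong₂ ℕ._+_ (cong indL (eq ℤ.≤-refl))
  (#L↑-cong n (λ p+1≤k → eq (ℤ.≤-trans (ℤ.<⇒≤ (p<p+1 p)) p+1≤k)))

#R↓-update-above : ∀ n {l p q} v → q < p → #R↓ (update l p v) q n ≡ #R↓ l q n
#R↓-update-above n {l} {p} v q<p =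
  #R↓-cong n (λ k≤q → update-agreeBelow l p v (ℤ.≤-<-trans k≤q q<p))

#L↑-update-below : ∀ n {l p q} v → p < q → #L↑ (update l p v) q n ≡ #L↑ l q n
#L↑-update-below n {l} {p} v p<q =
  #L↑-cong n (λ q≤k → update-agreeAbove l p v (ℤ.<-≤-trans p<q q≤k))

#R↓-update : ∀ n l p v → #R↓ (update l p v) p (suc n) ≡ indR v ℕ.+ #R↓ l (p - 1ℤ) n
#R↓-update n l p v =
  cong₂ ℕ._+_ (cong indR (update-same l p v)) (#R↓-update-above n v (p-1<p p))

#L↑-update : ∀ n l p v → #L↑ (update l p v) p (suc n) ≡ indL v ℕ.+ #L↑ l (p + 1ℤ) n
#L↑-update n l p v =
  cong₂ ℕ._+_ (cong indL (update-same l p v)) (#L↑-update-below n v (p<p+1 p))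

module Interval (X Y : ℤ) where

  Config : Set
  Config = (ℤ → Label) × ℤ

  data Move : Config → Config → Set where
    moveL : ∀ {l p} → X ≤ p → p ≤ Y → l p ≡ L → Move (l , p) (update l p R , p - 1ℤ)
    moveR : ∀ {l p} → X ≤ p → p ≤ Y → l p ≡ R → Move (l , p) (update l p L , p + 1ℤ)

  Run : Config → Config → Set
  Run = Star Move

  run-walk : ∀ {r s l p l′ q τ} → Run (l , p) (l′ , q) → Walk r s X Y l′ q τ → Walk r s X Y l p τ
  run-walk ε                   w = w
  run-walk (moveL a b c ◅ run) w = stepL a b c (run-walk run w)
  run-walk (moveR a b c ◅ run) w = stepR a b c (run-walk run w)

  LeftExit : ℕ → (ℤ → Label) → ℤ → Set
  LeftExit n l p = Σ (ℤ → Label) λ l′ → AgreeAbove p l′ l ×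
    (Run (l , p) (l′ , X - 1ℤ) ⊎ (Run (l , p) (l′ , p + 1ℤ) × #R↓ l′ p n ℕ.< #R↓ l p n))

  RightExit : ℕ → (ℤ → Label) → ℤ → Set
  RightExit n l p = Σ (ℤ → Label) λ l′ → AgreeBelow p l′ l ×
    (Run (l , p) (l′ , Y + 1ℤ) ⊎ (Run (l , p) (l′ , p - 1ℤ) × #L↑ l′ p n ℕ.< #L↑ l p n))

  leftExit-R : ∀ {n l p} → X ≤ p → p ≤ Y → l p ≡ R → LeftExit (suc n) l p
  leftExit-R {n} {l} {p} X≤p p≤Y lp =
    update l p L , update-agreeAbove l p L , inj₂ (moveR X≤p p≤Y lp ◅ ε , fewer)
    where
    fewer : #R↓ (update l p L) p (suc n) ℕ.< #R↓ l p (suc n)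
    fewer rewrite #R↓-update n l p L | lp = ℕ.n<1+n _

  leftExit-L : ∀ {n l p} → X ≤ p → p ≤ Y → l p ≡ L →
               LeftExit n (update l p R) (p - 1ℤ) → LeftExit (suc n) l p
  leftExit-L X≤p p≤Y lp (l′ , agree , inj₁ run) =
    l′ , agreeAbove-pred agree , inj₁ (moveL X≤p p≤Y lp ◅ run)
  leftExit-L {n} {l} {p} X≤p p≤Y lp (l′ , agree , inj₂ (run , fewer)) =
    update l′ p L ,
    (λ p<k → trans (update-agreeAbove l′ p L p<k) (agreeAbove-pred agree p<k)) ,
    inj₂ (moveL X≤p p≤Y lp ◅ subst (λ q → Run (update l p R , p - 1ℤ) (l′ , q)) (p-1+1≡p p) run
            ◅◅ moveR X≤p p≤Y l′p ◅ ε ,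
          fewer′)
    where
    l′p : l′ p ≡ R
    l′p = trans (agree (p-1<p p)) (update-same l p R)
    fewer′ : #R↓ (update l′ p L) p (suc n) ℕ.< #R↓ l p (suc n)
    fewer′ rewrite #R↓-update n l′ p L | lp =
      subst (#R↓ l′ (p - 1ℤ) n ℕ.<_) (#R↓-update-above n R (p-1<p p)) fewer

  leftExcursion : ∀ n l p → X + + n ≡ p + 1ℤ → p ≤ Y → LeftExit n l p
  leftExcursion zero l p X+0≡p+1 _ =
    l , (λ _ → refl) , inj₁ (subst (λ q → Run (l , p) (l , q)) (sym X-1≡p) ε)
    where
    X-1≡p : X - 1ℤ ≡ p
    X-1≡p = trans (cong (_- 1ℤ) (trans (sym (ℤ.+-identityʳ X)) X+0≡p+1)) (p+1-1≡p p)
  leftExcursion (suc n) l p X+n+1≡p+1 p≤Y = byLabel (l p) refl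
    where
    X+n≡p : X + + n ≡ p
    X+n≡p = +suc-cancel X n X+n+1≡p+1
    X≤p : X ≤ p
    X≤p = offset⇒≤ n X+n≡p
    byLabel : ∀ v → l p ≡ v → LeftExit (suc n) l p
    byLabel R lp = leftExit-R {n} X≤p p≤Y lp
    byLabel L lp = leftExit-L {n} X≤p p≤Y lp
      (leftExcursion n (update l p R) (p - 1ℤ) (trans X+n≡p (sym (p-1+1≡p p)))
                     (ℤ.≤-trans (ℤ.<⇒≤ (p-1<p p)) p≤Y))

  rightExit-L : ∀ {n l p} → X ≤ p → p ≤ Y → l p ≡ L → RightExit (suc n) l p
  rightExit-L {n} {l} {p} X≤p p≤Y lp =
    update l p R , update-agreeBelow l p R , inj₂ (moveL X≤p p≤Y lp ◅ ε , fewer)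
    where
    fewer : #L↑ (update l p R) p (suc n) ℕ.< #L↑ l p (suc n)
    fewer rewrite #L↑-update n l p R | lp = ℕ.n<1+n _

  rightExit-R : ∀ {n l p} → X ≤ p → p ≤ Y → l p ≡ R →
                RightExit n (update l p L) (p + 1ℤ) → RightExit (suc n) l p
  rightExit-R X≤p p≤Y lp (l′ , agree , inj₁ run) =
    l′ , agreeBelow-suc agree , inj₁ (moveR X≤p p≤Y lp ◅ run)
  rightExit-R {n} {l} {p} X≤p p≤Y lp (l′ , agree , inj₂ (run , fewer)) =
    update l′ p R ,
    (λ k<p → trans (update-agreeBelow l′ p R k<p) (agreeBelow-suc agree k<p)) ,
    inj₂ (moveR X≤p p≤Y lp ◅ subst (λ q → Run (update l p L , p + 1ℤ) (l′ , q)) (p+1-1≡p p) run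
            ◅◅ moveL X≤p p≤Y l′p ◅ ε ,
          fewer′)
    where
    l′p : l′ p ≡ L
    l′p = trans (agree (p<p+1 p)) (update-same l p L)
    fewer′ : #L↑ (update l′ p R) p (suc n) ℕ.< #L↑ l p (suc n)
    fewer′ rewrite #L↑-update n l′ p R | lp =
      subst (#L↑ l′ (p + 1ℤ) n ℕ.<_) (#L↑-update-below n L (p<p+1 p)) fewer

  rightExcursion : ∀ n l p → p + + n ≡ Y + 1ℤ → X ≤ p → RightExit n l p
  rightExcursion zero l p p+0≡Y+1 _ =
    l , (λ _ → refl) , inj₁ (subst (λ q → Run (l , p) (l , q)) p≡Y+1 ε)
    where
    p≡Y+1 : p ≡ Y + 1ℤ
    p≡Y+1 = trans (sym (ℤ.+-identityʳ p)) p+0≡Y+1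
  rightExcursion (suc n) l p p+n+1≡Y+1 X≤p = byLabel (l p) refl
    where
    p≤Y : p ≤ Y
    p≤Y = offset⇒≤ n (+suc-cancel p n p+n+1≡Y+1)
    byLabel : ∀ v → l p ≡ v → RightExit (suc n) l p
    byLabel L lp = rightExit-L {n} X≤p p≤Y lp
    byLabel R lp = rightExit-R {n} X≤p p≤Y lp
      (rightExcursion n (update l p L) (p + 1ℤ) (trans (ℤ.+-assoc p 1ℤ (+ n)) p+n+1≡Y+1)
                      (ℤ.≤-trans X≤p (ℤ.<⇒≤ (p<p+1 p))))

  module Boundary (c : ℤ) {n m : ℕ}
                  (X+n≡c+1 : X + + n ≡ c + 1ℤ) (c+1+m≡Y+1 : c + 1ℤ + + m ≡ Y + 1ℤ) where

    below above : (ℤ → Label) → ℕ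
    below l = #R↓ l c n
    above l = #L↑ l (c + 1ℤ) m

    Exits : (ℤ → Label) → ℤ → (ℕ → ℕ → Set) → (ℕ → ℕ → Set) → Set
    Exits l p _◁ₗ_ _◁ᵣ_ = Σ (ℤ → Label) λ l′ →
      (Run (l , p) (l′ , X - 1ℤ) × above l′ ◁ₗ above l) ⊎
      (Run (l , p) (l′ , Y + 1ℤ) × below l′ ◁ᵣ below l)

    above-agree : ∀ {l′ l} → AgreeAbove c l′ l → above l′ ≡ above l
    above-agree agree = #L↑-cong m (λ c+1≤k → agree (ℤ.<-≤-trans (p<p+1 c) c+1≤k))

    below-agree : ∀ {l′ l} → AgreeBelow (c + 1ℤ) l′ l → below l′ ≡ below l
    below-agree agree = #R↓-cong n (λ k≤c → agree (ℤ.≤-<-trans k≤c (p<p+1 c)))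

    prepend-c : ∀ {l l′} → Run (l , c) (l′ , c + 1ℤ) →
                below l′ ℕ.< below l → above l′ ≡ above l →
                Exits l′ (c + 1ℤ) ℕ._<_ ℕ._≤_ → Exits l c ℕ._≤_ ℕ._<_
    prepend-c run fewer same (l″ , inj₁ (run′ , lt)) =
      l″ , inj₁ (run ◅◅ run′ , ℕ.<⇒≤ (subst (_ ℕ.<_) same lt))
    prepend-c run fewer same (l″ , inj₂ (run′ , le)) =
      l″ , inj₂ (run ◅◅ run′ , ℕ.≤-<-trans le fewer)

    prepend-c+1 : ∀ {l l′} → Run (l , c + 1ℤ) (l′ , c) →
                  above l′ ℕ.< above l → below l′ ≡ below l →
                  Exits l′ c ℕ._≤_ ℕ._<_ → Exits l (c + 1ℤ) ℕ._<_ ℕ._≤_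
    prepend-c+1 run fewer same (l″ , inj₁ (run′ , le)) =
      l″ , inj₁ (run ◅◅ run′ , ℕ.≤-<-trans le fewer)
    prepend-c+1 run fewer same (l″ , inj₂ (run′ , lt)) =
      l″ , inj₂ (run ◅◅ run′ , ℕ.<⇒≤ (subst (_ ℕ.<_) same lt))

    c≤Y : c ≤ Y
    c≤Y = offset⇒≤ m (+suc-cancel c m (trans (sym (ℤ.+-assoc c 1ℤ (+ m))) c+1+m≡Y+1))

    exits-c-acc   : ∀ l → Acc ℕ._<_ (below l ℕ.+ above l) → Exits l c ℕ._≤_ ℕ._<_
    exits-c+1-acc : ∀ l → Acc ℕ._<_ (below l ℕ.+ above l) → Exits l (c + 1ℤ) ℕ._<_ ℕ._≤_

    exits-c-acc l (acc rec) with leftExcursion n l c X+n≡c+1 c≤Y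
    ... | l′ , agree , inj₁ run =
      l′ , inj₁ (run , ℕ.≤-reflexive (above-agree agree))
    ... | l′ , agree , inj₂ (run , fewer) = prepend-c run fewer (above-agree agree)
      (exits-c+1-acc l′ (rec (ℕ.+-mono-<-≤ fewer (ℕ.≤-reflexive (above-agree agree)))))

    exits-c+1-acc l (acc rec) with rightExcursion m l (c + 1ℤ) c+1+m≡Y+1 (offset⇒≤ n X+n≡c+1)
    ... | l′ , agree , inj₁ run =
      l′ , inj₂ (run , ℕ.≤-reflexive (below-agree agree))
    ... | l′ , agree , inj₂ (run , fewer) =
      prepend-c+1 (subst (λ q → Run (l , c + 1ℤ) (l′ , q)) (p+1-1≡p c) run) fewer (below-agree agree)
        (exits-c-acc l′ (rec (ℕ.+-mono-≤-< (ℕ.≤-reflexive (below-agree agree)) fewer)))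

    exits-c : ∀ l → Exits l c ℕ._≤_ ℕ._<_
    exits-c l = exits-c-acc l (<-wellFounded _)

    exits-c+1 : ∀ l → Exits l (c + 1ℤ) ℕ._<_ ℕ._≤_
    exits-c+1 l = exits-c+1-acc l (<-wellFounded _)

Eventually : ℕ → ℕ → State → (State → Set) → Set
Eventually r s σ P = Σ ℕ λ N → Σ State λ τ → Iter r s N σ τ × P τ

module _ {r s : ℕ} where

  iter-++ : ∀ {M N σ τ ρ} → Iter r s M σ τ → Iter r s N τ ρ → Iter r s (M ℕ.+ N) σ ρ
  iter-++ done       it′ = it′
  iter-++ (next f it) it′ = next f (iter-++ it it′)

  now : ∀ {σ P} → P σ → Eventually r s σ P
  now p = 0 , _ , done , p

  after : ∀ {σ τ P} → F r s σ τ → Eventually r s τ P → Eventually r s σ P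
  after f (N , ρ , it , p) = suc N , ρ , next f it , p

  eventually-map : ∀ {σ P Q} → (∀ {τ} → P τ → Q τ) → Eventually r s σ P → Eventually r s σ Q
  eventually-map g (N , τ , it , p) = N , τ , it , g p

  eventually-bind : ∀ {σ P Q} → Eventually r s σ P → (∀ {τ} → P τ → Eventually r s τ Q) →
                    Eventually r s σ Q
  eventually-bind (M , τ , it , p) k with k p
  ... | N , ρ , it′ , q = M ℕ.+ N , ρ , iter-++ it it′ , q

X-r<X : ∀ X r → 1 ℕ.≤ r → X - + r < X
X-r<X X r r≥1 = ℤ.≤-<-trans (ℤ.+-monoʳ-≤ X (ℤ.neg-mono-≤ (+≤+ r≥1))) (p-1<p X)

Y<Y+s : ∀ Y s → 1 ℕ.≤ s → Y < Y + + s
Y<Y+s Y s s≥1 = ℤ.<-≤-trans (p<p+1 Y) (ℤ.+-monoʳ-≤ Y (+≤+ s≥1))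

growsLeft : ∀ r s → 1 ℕ.≤ r → ∀ {X n} → X + + n ≡ 1ℤ → ∀ Y l → 0ℤ ≤ Y →
            Acc ℕ._<_ (#R↓ l 0ℤ n) →
            Eventually r s (mkState X Y l) (λ τ → lo τ < X × Y ≤ hi τ)
growsLeft r s r≥1 {X} {n} X+n≡1 Y l 0≤Y (acc rec) = continue (exits-c l)
  where
  offset : Σ ℕ λ m → 0ℤ + 1ℤ + + m ≡ Y + 1ℤ
  offset = ≤⇒offset (ℤ.+-monoˡ-≤ 1ℤ 0≤Y)
  open Interval X Y
  open Boundary 0ℤ X+n≡1 (proj₂ offset)
  0≤Y+s : 0ℤ ≤ Y + + s
  0≤Y+s = ℤ.≤-trans 0≤Y (ℤ.i≤i+j Y (+ s))
  continue : Exits l 0ℤ ℕ._≤_ ℕ._<_ → Eventually r s (mkState X Y l) (λ τ → lo τ < X × Y ≤ hi τ)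
  continue (l′ , inj₁ (run , _)) =
    after (run-walk run (exitL refl)) (now (X-r<X X r r≥1 , ℤ.≤-refl))
  continue (l′ , inj₂ (run , fewer)) =
    after (run-walk run (exitR refl))
      (eventually-map (λ (lt , le) → lt , ℤ.≤-trans (ℤ.i≤i+j Y (+ s)) le)
        (growsLeft r s r≥1 X+n≡1 (Y + + s) (setR l′ (Y + 1ℤ) (Y + + s)) 0≤Y+s
          (rec fewer′)))
    where
    fewer′ : #R↓ (setR l′ (Y + 1ℤ) (Y + + s)) 0ℤ n ℕ.< #R↓ l 0ℤ n
    fewer′ = subst (ℕ._< below l) (sym (#R↓-cong n (λ k≤0 →
      setR-below l′ _ _ (ℤ.≤-<-trans (ℤ.≤-trans k≤0 0≤Y) (p<p+1 Y))))) fewer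

growsRight : ∀ r s → 1 ℕ.≤ s → ∀ {Y m} → + m ≡ Y + 1ℤ → ∀ X l → X ≤ 0ℤ →
             Acc ℕ._<_ (#L↑ l 0ℤ m) →
             Eventually r s (mkState X Y l) (λ τ → lo τ ≤ X × Y < hi τ)
growsRight r s s≥1 {Y} {m} m≡Y+1 X l X≤0 (acc rec) = continue (exits-c+1 l)
  where
  offset : Σ ℕ λ n → X + + n ≡ 0ℤ
  offset = ≤⇒offset X≤0
  open Interval X Y
  open Boundary -1ℤ (proj₂ offset) m≡Y+1
  X-r≤0 : X - + r ≤ 0ℤ
  X-r≤0 = ℤ.≤-trans (ℤ.i-j≤i X (+ r)) X≤0
  continue : Exits l 0ℤ ℕ._<_ ℕ._≤_ → Eventually r s (mkState X Y l) (λ τ → lo τ ≤ X × Y < hi τ)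
  continue (l′ , inj₂ (run , _)) =
    after (run-walk run (exitR refl)) (now (ℤ.≤-refl , Y<Y+s Y s s≥1))
  continue (l′ , inj₁ (run , fewer)) =
    after (run-walk run (exitL refl))
      (eventually-map (λ (le , lt) → ℤ.≤-trans le (ℤ.i-j≤i X (+ r)) , lt)
        (growsRight r s s≥1 m≡Y+1 (X - + r) (setR l′ (X - + r) (X - 1ℤ)) X-r≤0
          (rec fewer′)))
    where
    fewer′ : #L↑ (setR l′ (X - + r) (X - 1ℤ)) 0ℤ m ℕ.< #L↑ l 0ℤ m
    fewer′ = subst (ℕ._< above l) (sym (#L↑-cong m (λ 0≤k →
      setR-above l′ _ _ (ℤ.<-≤-trans (ℤ.<-≤-trans (p-1<p X) X≤0) 0≤k)))) fewer

extendsLeft : ∀ r s → 1 ℕ.≤ r → ∀ σ → lo σ ≤ 0ℤ → 0ℤ ≤ hi σ →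
              Eventually r s σ (λ τ → lo τ < lo σ × hi σ ≤ hi τ)
extendsLeft r s r≥1 (mkState X Y l) X≤0 0≤Y =
  growsLeft r s r≥1 (proj₂ offset) Y l 0≤Y (<-wellFounded _)
  where
  offset : Σ ℕ λ n → X + + n ≡ 1ℤ
  offset = ≤⇒offset (ℤ.≤-trans X≤0 (+≤+ ℕ.z≤n))

extendsRight : ∀ r s → 1 ℕ.≤ s → ∀ σ → lo σ ≤ 0ℤ → 0ℤ ≤ hi σ →
               Eventually r s σ (λ τ → lo τ ≤ lo σ × hi σ < hi τ)
extendsRight r s s≥1 (mkState X Y l) X≤0 0≤Y =
  growsRight r s s≥1 (proj₂ offset) X l X≤0 (<-wellFounded _)
  where
  offset : Σ ℕ λ m → + m ≡ Y + 1ℤ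
  offset = ≤⇒offset (ℤ.≤-trans 0≤Y (ℤ.i≤i+j Y 1ℤ))

extendsBoth : ∀ r s → 1 ℕ.≤ r → 1 ℕ.≤ s → ∀ σ → lo σ ≤ 0ℤ → 0ℤ ≤ hi σ →
              Eventually r s σ (λ τ → lo τ < lo σ × hi σ < hi τ)
extendsBoth r s r≥1 s≥1 σ lo≤0 0≤hi =
  eventually-bind (extendsLeft r s r≥1 σ lo≤0 0≤hi) λ (lo′<lo , hi≤hi′) →
    eventually-map (λ (lo″≤lo′ , hi′<hi″) → ℤ.≤-<-trans lo″≤lo′ lo′<lo , ℤ.≤-<-trans hi≤hi′ hi′<hi″)
      (extendsRight r s s≥1 _ (ℤ.≤-trans (ℤ.<⇒≤ lo′<lo) lo≤0) (ℤ.≤-trans 0≤hi hi≤hi′))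

lemma2p1 : (r s : ℕ) → 1 Data.Nat.≤ r → 1 Data.Nat.≤ s →
    (x y : ℤ) → x ≤ 0ℤ → 0ℤ ≤ y → (σ : State) → InΣ x y σ →
    Σ ℕ λ N → Σ State λ τ → Iter r s N σ τ ×
      Σ ℤ λ x′ → Σ ℤ λ y′ → x′ < x × y < y′ × InΣ x′ y′ τ
lemma2p1 r s r≥1 s≥1 x y x≤0 0≤y σ (refl , refl) =
  let N , τ , it , (x′<x , y<y′) = extendsBoth r s r≥1 s≥1 σ x≤0 0≤y
  in  N , τ , it , lo τ , hi τ , x′<x , y<y′ , refl , refl
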